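{- Let $k\ge 3$ and let $G_k$ be the graph defined below (for $\ell=1$). Then there are exactly two edges in $G_k$ from a nonzero node of $B_2$ to a nonzero node of $B_1$, namely a blue edge from $II_t^k$ to $I_b^k$ and a red edge from $II_b^k$ to $I_b^k$.
   Context: The pruning function $\operatorname{P}_{1}:\mathbb{Z}_{>0}\to\mathbb{Z}_{\geq 0}$: write $m$ in binary, padded on the left with zeros as needed, let $z$ be the position (position $0$ = least significant bit) of the first zero bit counted from the right, let $q = 2^{z}\lfloor m/2^{z}\rfloor$, and set $\operatorname{P}_1(m)=\max(q-1,0)$. For an integer $k\ge 2$, $G_k$ is the directed graph with node set $\{0\}\cup\{2^{k-1}-1,\ldots,2^k-1\}$ and edges: for each $m$ with $2^{k-1}-1\le m<2^k-1$, a "blue" edge from $m$ to $m+1$ and a "red" edge from $\operatorname{P}_1(m)$ to $m$ (blue edges carry a fixed weight $-n$, red edges weight $+1$). For $k\ge 3$ set $I_t^k = 2^k-1$, $I_b^k=2^k-2^{k-2}-1$, $II_t^k=2^k-2^{k-2}-2$, $II_b^k=2^{k-1}-1$. $B_1$ of $G_k$ is the induced subgraph of $G_k$ on $\{0\}\cup\{I_b^k,\ldots,I_t^k\}$, and $B_2$ of $G_k$ is the induced subgraph on $\{0\}\cup\{II_b^k,\ldots,II_t^k\}$. -}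

module Defs where

open import Data.Nat using (ℕ; zero; suc; _+_; _*_; _∸_; _^_; _≤_; _<_; _/_; _%_)
open import Data.Product using (_×_)
open import Relation.Nullary using (¬_)
open import Relation.Binary.PropositionalEquality using (_≡_)

-- Position of the first zero bit of m (counted from the right, position 0 =
-- least significant bit), i.e. the number of trailing one bits of m.
-- The first argument is fuel; fuel m suffices since m halves at each step.
firstZeroAux : ℕ → ℕ → ℕ
firstZeroAux zero    m = zero
firstZeroAux (suc f) m with m % 2
... | zero  = zero
... | suc _ = suc (firstZeroAux f (m / 2))

firstZero : ℕ → ℕ
firstZero m = firstZeroAux (suc m) m

P₁ : ℕ → ℕ
P₁ m = (2 ^ firstZero m) * (m / (2 ^ firstZero m)) {{nz}} ∸ 1
  where
  open import Data.Nat.Properties using (m^n≢0)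
  nz = m^n≢0 2 (firstZero m)

data Colour : Set where
  blue red : Colour

data Edge (k : ℕ) : Colour → ℕ → ℕ → Set where
  blueEdge : ∀ m → 2 ^ (k ∸ 1) ∸ 1 ≤ m → m < 2 ^ k ∸ 1 → Edge k blue m (suc m)
  redEdge  : ∀ m → 2 ^ (k ∸ 1) ∸ 1 ≤ m → m < 2 ^ k ∸ 1 → Edge k red (P₁ m) m

I-t I-b II-t II-b : ℕ → ℕ
I-t  k = 2 ^ k ∸ 1
I-b  k = 2 ^ k ∸ 2 ^ (k ∸ 2) ∸ 1
II-t k = 2 ^ k ∸ 2 ^ (k ∸ 2) ∸ 2
II-b k = 2 ^ (k ∸ 1) ∸ 1

NonzeroB₁ : ℕ → ℕ → Set
NonzeroB₁ k v = ¬ (v ≡ 0) × I-b k ≤ v × v ≤ I-t k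

NonzeroB₂ : ℕ → ℕ → Set
NonzeroB₂ k v = ¬ (v ≡ 0) × II-b k ≤ v × v ≤ II-t k

-- Write a = 2^(k-2), so that I_t = 4a-1, I_b = 3a-1, II_t = 3a-2 and II_b = 2a-1.  A blue
-- edge m -> m+1 crosses from B₂ to B₁ only at m = II_t.  For a red edge P₁(m) -> m, the
-- number q = P₁(m) + 1 is m with its trailing one bits cleared.  For m = I_b, whose binary
-- expansion is 10 followed by k-2 ones, q = 2a and P₁(m) = II_b.  For the other targets
-- 3a ≤ m ≤ 4a-2 the number m+1 is not a multiple of a, so fewer than k-2 bits are cleared, q
-- stays at least 3a and P₁(m) ≥ I_b lies outside B₂.  (The argument works for every k ≥ 2.)
module Submission where

open import Defs
open import Data.Nat using (ℕ; zero; suc; _+_; _*_; _∸_; _^_; _≤_; _<_; _/_; _%_; s≤s; s≤s⁻¹)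
open import Data.Nat.Properties
open import Data.Nat.DivMod
open import Data.Nat.Tactic.RingSolver using (solve-∀)
open import Algebra.Properties.CommutativeSemigroup *-commutativeSemigroup using (x∙yz≈y∙xz)
open import Data.Product using (_×_; _,_)
open import Data.Sum using (_⊎_; inj₁; inj₂)
open import Relation.Nullary using (yes; no; contradiction)
open import Relation.Binary.PropositionalEquality
  using (_≡_; refl; sym; trans; cong; subst; subst₂; module ≡-Reasoning)

data EvenOrOdd : ℕ → Set where
  even : ∀ h → EvenOrOdd (2 * h)
  odd  : ∀ h → EvenOrOdd (suc (2 * h))

evenOrOdd : ∀ m → EvenOrOdd m
evenOrOdd zero = even 0
evenOrOdd (suc m) with evenOrOdd m
... | even h = odd h
... | odd h  = subst EvenOrOdd (*-suc 2 h) (even (suc h))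

[2*h]%2≡0 : ∀ h → 2 * h % 2 ≡ 0
[2*h]%2≡0 h = trans (cong (_% 2) (*-comm 2 h)) (m*n%n≡0 h 2)

[1+2*h]%2≡1 : ∀ h → suc (2 * h) % 2 ≡ 1
[1+2*h]%2≡1 h = trans (cong (λ x → suc x % 2) (*-comm 2 h)) ([m+kn]%n≡m%n 1 h 2)

[1+2*h]/2≡h : ∀ h → suc (2 * h) / 2 ≡ h
[1+2*h]/2≡h h = begin
  (1 + 2 * h) / 2        ≡⟨ cong (λ x → (1 + x) / 2) (*-comm 2 h) ⟩
  (1 + h * 2) / 2        ≡⟨ +-distrib-/ 1 (h * 2) (subst (λ r → 1 + r < 2) (sym (m*n%n≡0 h 2)) ≤-refl) ⟩
  1 / 2 + h * 2 / 2      ≡⟨ cong (0 +_) (m*n/n≡m h 2) ⟩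
  h                      ∎
  where open ≡-Reasoning

firstZeroAux-fuel : ∀ {f g} m → m < f → m < g → firstZeroAux f m ≡ firstZeroAux g m
firstZeroAux-fuel {suc f} {suc g} zero    _         _         = refl
firstZeroAux-fuel {suc f} {suc g} (suc m) (s≤s m<f) (s≤s m<g) with suc m % 2
... | zero  = refl
... | suc _ = cong suc (firstZeroAux-fuel (suc m / 2) (<-≤-trans half<m m<f) (<-≤-trans half<m m<g))
  where
  half<m : suc m / 2 < suc m
  half<m = m/n<m (suc m) 2 ≤-refl

firstZeroAux-even : ∀ f m → m % 2 ≡ 0 → firstZeroAux (suc f) m ≡ 0
firstZeroAux-even f m m%2≡0 rewrite m%2≡0 = refl

firstZeroAux-odd : ∀ f m → m % 2 ≡ 1 → firstZeroAux (suc f) m ≡ suc (firstZeroAux f (m / 2))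
firstZeroAux-odd f m m%2≡1 rewrite m%2≡1 = refl

firstZero-even : ∀ h → firstZero (2 * h) ≡ 0
firstZero-even h = firstZeroAux-even (2 * h) (2 * h) ([2*h]%2≡0 h)

firstZero-odd : ∀ h → firstZero (suc (2 * h)) ≡ suc (firstZero h)
firstZero-odd h = begin
  firstZero (suc (2 * h))                               ≡⟨ firstZeroAux-odd (suc (2 * h)) (suc (2 * h)) ([1+2*h]%2≡1 h) ⟩
  suc (firstZeroAux (suc (2 * h)) (suc (2 * h) / 2))    ≡⟨ cong (λ x → suc (firstZeroAux (suc (2 * h)) x)) ([1+2*h]/2≡h h) ⟩
  suc (firstZeroAux (suc (2 * h)) h)                    ≡⟨ cong suc (firstZeroAux-fuel h (s≤s (m≤n*m h 2)) ≤-refl) ⟩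
  suc (firstZero h)                                     ∎
  where open ≡-Reasoning

roundDown : ℕ → ℕ → ℕ
roundDown z m = 2 ^ z * (m / 2 ^ z) {{m^n≢0 2 z}}

roundDown-zero : ∀ m → roundDown 0 m ≡ m
roundDown-zero m = trans (*-identityˡ (m / 1)) (n/1≡n m)

roundDown-suc : ∀ z m → roundDown (suc z) m ≡ 2 * roundDown z (m / 2)
roundDown-suc z m = begin
  2 * 2 ^ z * (m / (2 * 2 ^ z)) {{m^n≢0 2 (suc z)}}
    ≡⟨ cong (2 * 2 ^ z *_) (sym (m/n/o≡m/[n*o] m 2 (2 ^ z) {{_}} {{m^n≢0 2 z}} {{m^n≢0 2 (suc z)}})) ⟩
  2 * 2 ^ z * ((m / 2) / 2 ^ z) {{m^n≢0 2 z}}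
    ≡⟨ *-assoc 2 (2 ^ z) _ ⟩
  2 * roundDown z (m / 2) ∎
  where open ≡-Reasoning

-- The paper's q; P₁ m is clearTrailingOnes m ∸ 1 by definition.
clearTrailingOnes : ℕ → ℕ
clearTrailingOnes m = roundDown (firstZero m) m

clearTrailingOnes-even : ∀ h → clearTrailingOnes (2 * h) ≡ 2 * h
clearTrailingOnes-even h = trans (cong (λ z → roundDown z (2 * h)) (firstZero-even h)) (roundDown-zero (2 * h))

clearTrailingOnes-odd : ∀ h → clearTrailingOnes (suc (2 * h)) ≡ 2 * clearTrailingOnes h
clearTrailingOnes-odd h = begin
  roundDown (firstZero (suc (2 * h))) (suc (2 * h))   ≡⟨ cong (λ z → roundDown z (suc (2 * h))) (firstZero-odd h) ⟩
  roundDown (suc (firstZero h)) (suc (2 * h))         ≡⟨ roundDown-suc (firstZero h) (suc (2 * h)) ⟩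
  2 * roundDown (firstZero h) (suc (2 * h) / 2)       ≡⟨ cong (λ x → 2 * roundDown (firstZero h) x) ([1+2*h]/2≡h h) ⟩
  2 * clearTrailingOnes h                             ∎
  where open ≡-Reasoning

2*m≤1+2*n⇒m≤n : ∀ {m n} → 2 * m ≤ suc (2 * n) → m ≤ n
2*m≤1+2*n⇒m≤n {m} {n} p = s≤s⁻¹ (*-cancelˡ-< 2 m (suc n) (≤-trans (s≤s p) (≤-reflexive (sym (*-suc 2 n)))))

clearTrailingOnes-≥ : ∀ n c m → c * 2 ^ n ≤ m → suc m < suc c * 2 ^ n → c * 2 ^ n ≤ clearTrailingOnes m
clearTrailingOnes-≥ zero c m lo hi =
  contradiction (subst (_≤ m) (*-identityʳ c) lo) (<⇒≱ (s≤s⁻¹ (subst (suc m <_) (*-identityʳ (suc c)) hi)))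
clearTrailingOnes-≥ (suc n) c m lo hi with evenOrOdd m
... | even h = subst (c * 2 ^ suc n ≤_) (sym (clearTrailingOnes-even h)) lo
... | odd h  = begin
  c * (2 * 2 ^ n)               ≡⟨ x∙yz≈y∙xz c 2 (2 ^ n) ⟩
  2 * (c * 2 ^ n)               ≤⟨ *-monoʳ-≤ 2 (clearTrailingOnes-≥ n c h lo′ hi′) ⟩
  2 * clearTrailingOnes h       ≡⟨ sym (clearTrailingOnes-odd h) ⟩
  clearTrailingOnes (suc (2 * h)) ∎
  where
  open ≤-Reasoning
  lo′ : c * 2 ^ n ≤ h
  lo′ = 2*m≤1+2*n⇒m≤n (subst (_≤ suc (2 * h)) (x∙yz≈y∙xz c 2 (2 ^ n)) lo)
  hi′ : suc h < suc c * 2 ^ n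
  hi′ = *-cancelˡ-< 2 (suc h) (suc c * 2 ^ n)
          (subst₂ _<_ (sym (*-suc 2 h)) (x∙yz≈y∙xz (suc c) 2 (2 ^ n)) hi)

clearTrailingOnes-ones : ∀ n d m → suc m ≡ suc (2 * d) * 2 ^ n → clearTrailingOnes m ≡ 2 * d * 2 ^ n
clearTrailingOnes-ones zero d m eq = begin
  clearTrailingOnes m        ≡⟨ cong clearTrailingOnes m≡2d ⟩
  clearTrailingOnes (2 * d)  ≡⟨ clearTrailingOnes-even d ⟩
  2 * d                      ≡⟨ sym (*-identityʳ (2 * d)) ⟩
  2 * d * 1                  ∎
  where
  open ≡-Reasoning
  m≡2d : m ≡ 2 * d
  m≡2d = suc-injective (trans eq (*-identityʳ (suc (2 * d))))
clearTrailingOnes-ones (suc n) d m eq with evenOrOdd m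
... | even h = contradiction (sym (trans eq (x∙yz≈y∙xz (suc (2 * d)) 2 (2 ^ n)))) (even≢odd (suc (2 * d) * 2 ^ n) h)
... | odd h  = begin
  clearTrailingOnes (suc (2 * h))   ≡⟨ clearTrailingOnes-odd h ⟩
  2 * clearTrailingOnes h           ≡⟨ cong (2 *_) (clearTrailingOnes-ones n d h suc-h≡) ⟩
  2 * (2 * d * 2 ^ n)               ≡⟨ x∙yz≈y∙xz 2 (2 * d) (2 ^ n) ⟩
  2 * d * (2 * 2 ^ n)               ∎
  where
  open ≡-Reasoning
  suc-h≡ : suc h ≡ suc (2 * d) * 2 ^ n
  suc-h≡ = *-cancelˡ-≡ (suc h) _ 2 (trans (*-suc 2 h) (trans eq (x∙yz≈y∙xz (suc (2 * d)) 2 (2 ^ n))))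

-- With 2ⁿ = 1 + b the node values of G_(2+n) become free of truncated subtraction.
module Nodes {n b : ℕ} (2ⁿ≡1+b : 2 ^ n ≡ suc b) where

  4[1+b]∸[1+b]≡3+3b : 2 * (2 * suc b) ∸ suc b ≡ 3 + 3 * b
  4[1+b]∸[1+b]≡3+3b = trans (cong (_∸ suc b) (expand b)) (m+n∸m≡n (suc b) (3 + 3 * b))
    where
    expand : ∀ b → 2 * (2 * suc b) ≡ suc b + (3 + 3 * b)
    expand = solve-∀

  I-t≡ : I-t (2 + n) ≡ 3 + 4 * b
  I-t≡ = trans (cong (λ a → 2 * (2 * a) ∸ 1) 2ⁿ≡1+b) (cong (_∸ 1) (expand b))
    where
    expand : ∀ b → 2 * (2 * suc b) ≡ 4 + 4 * b
    expand = solve-∀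

  I-b≡ : I-b (2 + n) ≡ 2 + 3 * b
  I-b≡ = trans (cong (λ a → 2 * (2 * a) ∸ a ∸ 1) 2ⁿ≡1+b) (cong (_∸ 1) 4[1+b]∸[1+b]≡3+3b)

  II-t≡ : II-t (2 + n) ≡ 1 + 3 * b
  II-t≡ = trans (cong (λ a → 2 * (2 * a) ∸ a ∸ 2) 2ⁿ≡1+b) (cong (_∸ 2) 4[1+b]∸[1+b]≡3+3b)

  II-b≡ : II-b (2 + n) ≡ 1 + 2 * b
  II-b≡ = trans (cong (λ a → 2 * a ∸ 1) 2ⁿ≡1+b) (cong (_∸ 1) (*-suc 2 b))

  suc-II-t≡I-b : suc (II-t (2 + n)) ≡ I-b (2 + n)
  suc-II-t≡I-b = trans (cong suc II-t≡) (sym I-b≡)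

  suc-I-b≡3*2ⁿ : suc (I-b (2 + n)) ≡ 3 * 2 ^ n
  suc-I-b≡3*2ⁿ = trans (cong suc I-b≡) (trans (sym (*-suc 3 b)) (cong (3 *_) (sym 2ⁿ≡1+b)))

  suc-I-t≡4*2ⁿ : suc (I-t (2 + n)) ≡ 4 * 2 ^ n
  suc-I-t≡4*2ⁿ = trans (cong suc I-t≡) (trans (sym (*-suc 4 b)) (cong (4 *_) (sym 2ⁿ≡1+b)))

  II-t<I-b : II-t (2 + n) < I-b (2 + n)
  II-t<I-b = ≤-reflexive suc-II-t≡I-b

  II-b≤II-t : II-b (2 + n) ≤ II-t (2 + n)
  II-b≤II-t = subst₂ _≤_ (sym II-b≡) (sym II-t≡) (s≤s (*-monoˡ-≤ b (n≤1+n 2)))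

  I-b<I-t : I-b (2 + n) < I-t (2 + n)
  I-b<I-t = subst₂ _<_ (sym I-b≡) (sym I-t≡) (s≤s (s≤s (s≤s (*-monoˡ-≤ b (n≤1+n 3)))))

  P₁-I-b : P₁ (I-b (2 + n)) ≡ II-b (2 + n)
  P₁-I-b = cong (_∸ 1) (clearTrailingOnes-ones n 1 (I-b (2 + n)) suc-I-b≡3*2ⁿ)

  I-b≤P₁ : ∀ {m} → I-b (2 + n) < m → m < I-t (2 + n) → I-b (2 + n) ≤ P₁ m
  I-b≤P₁ {m} I-b<m m<I-t = begin
    I-b (2 + n)     ≡⟨ cong (_∸ 1) suc-I-b≡3*2ⁿ ⟩
    3 * 2 ^ n ∸ 1   ≤⟨ ∸-monoˡ-≤ 1 (clearTrailingOnes-≥ n 3 m 3*2ⁿ≤m (subst (suc m <_) suc-I-t≡4*2ⁿ (s≤s m<I-t))) ⟩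
    P₁ m            ∎
    where
    open ≤-Reasoning
    3*2ⁿ≤m : 3 * 2 ^ n ≤ m
    3*2ⁿ≤m = subst (_≤ m) suc-I-b≡3*2ⁿ I-b<m

  blueEdge-II-t→I-b : Edge (2 + n) blue (II-t (2 + n)) (I-b (2 + n))
  blueEdge-II-t→I-b = subst (Edge (2 + n) blue (II-t (2 + n))) suc-II-t≡I-b
    (blueEdge (II-t (2 + n)) II-b≤II-t (<-trans II-t<I-b I-b<I-t))

  redEdge-II-b→I-b : Edge (2 + n) red (II-b (2 + n)) (I-b (2 + n))
  redEdge-II-b→I-b = subst (λ u → Edge (2 + n) red u (I-b (2 + n))) P₁-I-b
    (redEdge (I-b (2 + n)) (≤-trans II-b≤II-t (<⇒≤ II-t<I-b)) I-b<I-t)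

  B₂→B₁-edge : ∀ c u v → Edge (2 + n) c u v → NonzeroB₂ (2 + n) u → NonzeroB₁ (2 + n) v →
    (c , u , v) ≡ (blue , II-t (2 + n) , I-b (2 + n)) ⊎ (c , u , v) ≡ (red , II-b (2 + n) , I-b (2 + n))
  B₂→B₁-edge .blue m .(suc m) (blueEdge m _ _) (_ , _ , m≤II-t) (_ , I-b≤1+m , _)
    with ≤-antisym m≤II-t (s≤s⁻¹ (subst (_≤ suc m) (sym suc-II-t≡I-b) I-b≤1+m))
  ... | refl = inj₁ (cong (λ v → blue , II-t (2 + n) , v) suc-II-t≡I-b)
  B₂→B₁-edge .red .(P₁ m) m (redEdge m _ m<I-t) (_ , _ , P₁m≤II-t) (_ , I-b≤m , _) with I-b (2 + n) ≟ m
  ... | yes refl   = inj₂ (cong (λ u → red , u , I-b (2 + n)) P₁-I-b)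
  ... | no I-b≢m  = contradiction (≤-trans (I-b≤P₁ (≤∧≢⇒< I-b≤m I-b≢m) m<I-t) P₁m≤II-t) (<⇒≱ II-t<I-b)

mainTheorem9 : (k : ℕ) → 3 ≤ k →
    (Edge k blue (II-t k) (I-b k) × Edge k red (II-b k) (I-b k))
    × (∀ c u v → Edge k c u v → NonzeroB₂ k u → NonzeroB₁ k v →
    (c , u , v) ≡ (blue , II-t k , I-b k) ⊎ (c , u , v) ≡ (red , II-b k , I-b k))
mainTheorem9 (suc (suc n)) (s≤s (s≤s _)) = (blueEdge-II-t→I-b , redEdge-II-b→I-b) , B₂→B₁-edge
  where open Nodes {n} (sym (m+[n∸m]≡n (m^n>0 2 n)))
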